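{- A finite, undirected, connected graph $\Gamma$ is 3-GNDB with $\gamma_\Gamma=2$ if and only if $\Gamma$ is isomorphic to $K_{2,6}$.
   Context: All graphs are finite, simple, undirected and connected, with at least one edge. For vertices $a,b$, $d(a,b)$ denotes the length of a shortest $a$–$b$ path. For an edge $ab$, $W_{ab}=\{x\in V(\Gamma)\mid d(x,a)<d(x,b)\}$. A graph $\Gamma$ is called generalized 3-nicely distance-balanced (3-GNDB) if there is a positive integer $\gamma_\Gamma$ such that for every edge $ab$ of $\Gamma$, one of $|W_{ab}|,|W_{ba}|$ equals $3$ times the other, and the smaller of the two equals $\gamma_\Gamma$. -}

module Defs where

open import Data.Nat using (ℕ; zero; suc; _<ᵇ_; _*_)
open import Data.Bool using (Bool; true; false; _∧_; _∨_; if_then_else_)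
open import Data.Fin using (Fin; toℕ)
open import Data.Fin.Properties using (_≟_)
open import Data.List using (List; allFin; filterᵇ; length)
open import Data.Bool.ListAction using (any)
open import Data.Product using (Σ; _×_; ∃)
open import Data.Sum using (_⊎_)
open import Function.Bundles using (_⤖_; Bijection)
open import Relation.Nullary.Decidable using (⌊_⌋)
open import Relation.Binary.PropositionalEquality using (_≡_)

record Graph : Set where
  field
    n     : ℕ
    adj   : Fin n → Fin n → Bool
    sym   : ∀ x y → adj x y ≡ adj y x
    irrefl : ∀ x → adj x x ≡ false
open Graph public

module _ (G : Graph) where
  private
    V = Fin (n G)

  data Walk : V → V → ℕ → Set where
    here : ∀ a → Walk a a zero
    step : ∀ {a b c k} → adj G a b ≡ true → Walk b c k → Walk a c (suc k)

  Connected : Set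
  Connected = ∀ a b → ∃ λ k → Walk a b k

  HasEdge : Set
  HasEdge = Σ V λ a → Σ V λ b → adj G a b ≡ true

  reach : ℕ → V → V → Bool
  reach zero a b = ⌊ a ≟ b ⌋
  reach (suc k) a b = reach k a b ∨ any (λ c → adj G a c ∧ reach k c b) (allFin (n G))

  private
    search : ℕ → ℕ → V → V → ℕ
    search zero k a b = k
    search (suc f) k a b = if reach k a b then k else search f (suc k) a b

  -- d(a,b): length of a shortest a–b path (for connected graphs; a shortest
  -- path has length < n, so searching k = 0 .. n suffices)
  dist : V → V → ℕ
  dist a b = search (n G) 0 a b

  W : V → V → ℕ
  W a b = length (filterᵇ (λ x → dist x a <ᵇ dist x b) (allFin (n G)))

  Is3GNDBWith : ℕ → Set
  Is3GNDBWith γ = ∀ a b → adj G a b ≡ true →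
    (W a b ≡ 3 * W b a × W b a ≡ γ) ⊎ (W b a ≡ 3 * W a b × W a b ≡ γ)

_≅_ : Graph → Graph → Set
G ≅ H = Σ (Fin (n G) ⤖ Fin (n H)) λ f →
  ∀ x y → adj G x y ≡ adj H (Bijection.to f x) (Bijection.to f y)

private
  part : Fin 8 → Bool
  part x = toℕ x <ᵇ 2

  xor : Bool → Bool → Bool
  xor true  b = if b then false else true
  xor false b = b

  xor-sym : ∀ a b → xor a b ≡ xor b a
  xor-sym true true = _≡_.refl
  xor-sym true false = _≡_.refl
  xor-sym false true = _≡_.refl
  xor-sym false false = _≡_.refl

  xor-self : ∀ a → xor a a ≡ false
  xor-self true = _≡_.refl
  xor-self false = _≡_.refl

K₂₆ : Graph
K₂₆ = record
  { n = 8
  ; adj = λ x y → xor (part x) (part y)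
  ; sym = λ x y → xor-sym (part x) (part y)
  ; irrefl = λ x → xor-self (part x)
  }

-- Along an edge ab the transmission T(v) = Σₓ d(x,v) satisfies T(b) + |W_ba| = T(a) + |W_ab|.
-- In a 3-GNDB graph with γ = 2 the sides of every edge have sizes 2 and 6, so adjacent
-- transmissions differ by 4: bit 2 of T is a proper 2-colouring, hence |W_ab| + |W_ba| = n = 8.
-- A shortest path x v₁ ⋯ v₇ would put v₁, …, v₇ into W_{v₁x}, so every distance is below 7.
-- At a vertex h of least transmission each neighbour b has W_bh = {b, c_b} with c_b ~ b, and
-- every vertex is within distance 2 of h. If some edge b c_b has its small side at b, then h and
-- c_b are adjacent to the six other vertices and Γ ≅ K_{2,6}; otherwise every c_b has degree 2 and
-- double counting the edges between N(h) and the c_b gives 8 = 1 + 3k. Conversely, in K_{2,6}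
-- the set W_ab is a together with the part of b minus b.
module Submission where

open import Defs hiding (sym)
open import Data.Bool using (Bool; true; false; T; not; _∧_; _∨_; _xor_; if_then_else_)
open import Data.Bool.Properties
  using (T-≡; T?; not-involutive; not-¬; ¬-not; xor-same; xor-inverseʳ)
  renaming (_≟_ to _≟ᵇ_)
open import Data.Empty using (⊥; ⊥-elim)
open import Data.Fin using (Fin; zero; suc; toℕ)
open import Data.Fin.Permutation using (Permutation; transpose; _∘ₚ_; _⟨$⟩ʳ_; _⟨$⟩ˡ_; inverseˡ; ↔⇒≡)
import Data.Fin.Permutation.Components as PC
open import Data.Fin.Properties using (_≟_; any?; toℕ<n; toℕ-injective) renaming (suc-injective to Fin-suc-injective)
open import Data.List using (allFin; tabulate; filterᵇ; length)
open import Data.List.Extrema.Nat using (argmin; f[argmin]≤f[xs])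
open import Data.List.Membership.Propositional using (lose)
open import Data.List.Membership.Propositional.Properties using (∈-allFin)
open import Data.List.Relation.Unary.All using (lookup)
open import Data.List.Relation.Unary.Any using (satisfied)
open import Data.List.Relation.Unary.Any.Properties using (any⁺; any⁻)
open import Data.Nat using (ℕ; zero; suc; _+_; _*_; _≤_; _<_; _<ᵇ_; z≤n; s≤s; _<?_; _≤?_) renaming (_≟_ to _≟ℕ_)
open import Data.Nat.GeneralisedArithmetic using (iterate)
open import Data.Nat.Properties hiding (_≟_)
open import Data.Product using (Σ; ∃; ∃₂; _×_; _,_; proj₁; proj₂)
open import Data.Sum using (_⊎_; inj₁; inj₂)
open import Data.Unit using (tt)
open import Function using (_∘_; id)
open import Function.Bundles using (_⇔_; mk⇔; _⤖_; Bijection; Equivalence)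
open import Function.Properties.Bijection using (⤖⇒↔)
open import Function.Properties.Inverse using (↔⇒⤖)
open import Relation.Nullary using (¬_; Dec; yes; no; contradiction)
open import Relation.Nullary.Decidable
  using (⌊_⌋; _×-dec_; map′; toWitness; fromWitness; from-no; dec-true; dec-false; isYes≗does; does-⇔)
open import Relation.Binary.PropositionalEquality
open import Algebra.Properties.CommutativeMonoid.Sum +-0-commutativeMonoid
  using (sum; sum-syntax; ∑-distrib-+; ∑-comm; ∑-permute; sum-cong-≗; sum-replicate-zero)

⌊⌋-yes : ∀ {A : Set} (a? : Dec A) → A → ⌊ a? ⌋ ≡ true
⌊⌋-yes a? a = trans (isYes≗does a?) (dec-true a? a)

⌊⌋-no : ∀ {A : Set} (a? : Dec A) → ¬ A → ⌊ a? ⌋ ≡ false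
⌊⌋-no a? ¬a = trans (isYes≗does a?) (dec-false a? ¬a)

⌊⌋-sound : ∀ {A : Set} (a? : Dec A) → ⌊ a? ⌋ ≡ true → A
⌊⌋-sound (yes a) _ = a

𝟙 : Bool → ℕ
𝟙 true  = 1
𝟙 false = 0

count : ∀ {m} → (Fin m → Bool) → ℕ
count {m} P = ∑[ x < m ] 𝟙 (P x)

_∖_ : ∀ {m} → (Fin m → Bool) → Fin m → (Fin m → Bool)
(P ∖ v) x = not ⌊ x ≟ v ⌋ ∧ P x

pair : ∀ {m} → Fin m → Fin m → Fin m → Bool
pair u v x = ⌊ x ≟ u ⌋ ∨ ⌊ x ≟ v ⌋

private
  variable
    m j k : ℕ
    P Q : Fin m → Bool
    u v w : Fin m

length-filterᵇ-tabulate : ∀ {A : Set} (P : A → Bool) (f : Fin m → A) →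
                          length (filterᵇ P (tabulate f)) ≡ count (P ∘ f)
length-filterᵇ-tabulate {zero}  P f = refl
length-filterᵇ-tabulate {suc m} P f with P (f zero)
... | true  = cong suc (length-filterᵇ-tabulate P (f ∘ suc))
... | false = length-filterᵇ-tabulate P (f ∘ suc)

∑-mono-≤ : ∀ {f g : Fin m → ℕ} → (∀ i → f i ≤ g i) → sum f ≤ sum g
∑-mono-≤ {zero}  f≤g = z≤n
∑-mono-≤ {suc m} f≤g = +-mono-≤ (f≤g zero) (∑-mono-≤ (f≤g ∘ suc))

count-cong : (∀ x → P x ≡ Q x) → count P ≡ count Q
count-cong P≗Q = sum-cong-≗ (cong 𝟙 ∘ P≗Q)

count-false : ∀ m → count {m} (λ _ → false) ≡ 0
count-false m = sum-replicate-zero m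

count-true : ∀ m → count {m} (λ _ → true) ≡ m
count-true zero    = refl
count-true (suc m) = cong suc (count-true m)

count-≟ : (v : Fin m) → count (λ x → ⌊ x ≟ v ⌋) ≡ 1
count-≟ {suc m} zero    = cong suc (count-false m)
count-≟ {suc m} (suc v) = trans (count-cong suc≟suc) (count-≟ v)
  where
  suc≟suc : ∀ x → ⌊ Fin.suc x ≟ suc v ⌋ ≡ ⌊ x ≟ v ⌋
  suc≟suc x = trans (isYes≗does (suc x ≟ suc v)) (sym (isYes≗does (x ≟ v)))

∖-intro : w ≢ v → P w ≡ true → (P ∖ v) w ≡ true
∖-intro {w = w} {v} w≢v Pw = trans (cong (λ b → not b ∧ _) (⌊⌋-no (w ≟ v) w≢v)) Pw

∖-elim : (P ∖ v) w ≡ true → w ≢ v × P w ≡ true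
∖-elim {v = v} {w = w} e with w ≟ v
... | no w≢v = w≢v , e

count-remove : (v : Fin m) → P v ≡ true → count P ≡ suc (count (P ∖ v))
count-remove {P = P} v Pv = begin
  count P                                          ≡⟨ sum-cong-≗ split ⟩
  ∑[ x < _ ] (𝟙 ⌊ x ≟ v ⌋ + 𝟙 ((P ∖ v) x))         ≡⟨ ∑-distrib-+ (λ x → 𝟙 ⌊ x ≟ v ⌋) (𝟙 ∘ (P ∖ v)) ⟩
  count (λ x → ⌊ x ≟ v ⌋) + count (P ∖ v)          ≡⟨ cong (_+ count (P ∖ v)) (count-≟ v) ⟩
  suc (count (P ∖ v))                              ∎
  where
  open ≡-Reasoning
  split : ∀ x → 𝟙 (P x) ≡ 𝟙 ⌊ x ≟ v ⌋ + 𝟙 ((P ∖ v) x)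
  split x with x ≟ v
  ... | yes refl = cong 𝟙 Pv
  ... | no _     = refl

count-pos : ∀ x → P x ≡ true → 1 ≤ count P
count-pos x Px = subst (1 ≤_) (sym (count-remove x Px)) (s≤s z≤n)

count-pos⇒∃ : 1 ≤ count P → ∃ λ x → P x ≡ true
count-pos⇒∃ {suc m} {P} pos with P zero in P0
... | true  = zero , P0
... | false with count-pos⇒∃ {P = P ∘ suc} pos
...   | x , Px = suc x , Px

injection≤count : (f : Fin k → Fin m) → (∀ {i j} → f i ≡ f j → i ≡ j) →
                  (∀ i → P (f i) ≡ true) → k ≤ count P
injection≤count {zero}  f f-inj Pf = z≤n
injection≤count {suc k} {P = P} f f-inj Pf =
  subst (suc k ≤_) (sym (count-remove (f zero) (Pf zero)))
    (s≤s (injection≤count (f ∘ suc) (Fin-suc-injective ∘ f-inj) P∖f₀))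
  where
  P∖f₀ : ∀ i → (P ∖ f zero) (f (suc i)) ≡ true
  P∖f₀ i = ∖-intro {P = P} (λ e → contradiction (f-inj e) λ ()) (Pf (suc i))

count≡1⇒unique : count P ≡ 1 → P w ≡ true → P v ≡ true → w ≡ v
count≡1⇒unique {P = P} {w} {v} #P≡1 Pw Pv with w ≟ v
... | yes w≡v = w≡v
... | no  w≢v = contradiction (subst (2 ≤_) #P≡1 two≤) (1+n≰n {1})
  where
  two≤ : 2 ≤ count P
  two≤ = subst (2 ≤_) (sym (count-remove v Pv)) (s≤s (count-pos w (∖-intro {P = P} w≢v Pw)))

count≡1-intro : P u ≡ true → (∀ x → P x ≡ true → x ≡ u) → count P ≡ 1
count≡1-intro {m} {P} {u} Pu unique = trans (count-remove u Pu) (cong suc (trans (count-cong none) (count-false m)))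
  where
  none : ∀ x → (P ∖ u) x ≡ false
  none x with (P ∖ u) x in e
  ... | false = refl
  ... | true  = contradiction (unique x (proj₂ (∖-elim {P = P} e))) (proj₁ (∖-elim {P = P} e))

count≡2 : (u : Fin m) → P u ≡ true → count P ≡ 2 →
          ∃ λ v → v ≢ u × P v ≡ true × (∀ x → P x ≡ true → x ≡ u ⊎ x ≡ v)
count≡2 {P = P} u Pu #P≡2 = u′ , proj₁ (∖-elim {P = P} P∖u-u′) , proj₂ (∖-elim {P = P} P∖u-u′) , cover
  where
  #P∖u≡1 : count (P ∖ u) ≡ 1
  #P∖u≡1 = suc-injective (trans (sym (count-remove u Pu)) #P≡2)
  witness : ∃ λ x → (P ∖ u) x ≡ true
  witness = count-pos⇒∃ (≤-reflexive (sym #P∖u≡1))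
  u′ = proj₁ witness
  P∖u-u′ = proj₂ witness
  cover : ∀ x → P x ≡ true → x ≡ u ⊎ x ≡ u′
  cover x Px with x ≟ u
  ... | yes x≡u = inj₁ x≡u
  ... | no  x≢u = inj₂ (count≡1⇒unique #P∖u≡1 (∖-intro {P = P} x≢u Px) P∖u-u′)

count≡2-intro : u ≢ v → P u ≡ true → P v ≡ true → (∀ x → P x ≡ true → x ≡ u ⊎ x ≡ v) → count P ≡ 2
count≡2-intro {u = u} {v} {P} u≢v Pu Pv cover =
  trans (count-remove u Pu) (cong suc (count≡1-intro (∖-intro {P = P} (u≢v ∘ sym) Pv) only-v))
  where
  only-v : ∀ x → (P ∖ u) x ≡ true → x ≡ v
  only-v x P∖u-x with ∖-elim {P = P} P∖u-x
  ... | x≢u , Px with cover x Px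
  ...   | inj₁ x≡u = contradiction x≡u x≢u
  ...   | inj₂ x≡v = x≡v

pair-elim : pair u v w ≡ true → w ≡ u ⊎ w ≡ v
pair-elim {u = u} {v} {w} e with w ≟ u | w ≟ v
... | yes w≡u | _       = inj₁ w≡u
... | no  _   | yes w≡v = inj₂ w≡v

pair-false : pair u v w ≡ false → w ≢ u × w ≢ v
pair-false {u = u} {v} {w} e with w ≟ u | w ≟ v
... | no w≢u | no w≢v = w≢u , w≢v

module Walks (G : Graph) where

  V : Set
  V = Fin (n G)

  infix 4 _~_
  _~_ : V → V → Set
  a ~ b = adj G a b ≡ true

  private
    variable
      a b c : V

  ~-sym : a ~ b → b ~ a
  ~-sym {a} {b} a~b = trans (Graph.sym G b a) a~b

  ~-irrefl : a ~ b → a ≢ b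
  ~-irrefl {a} a~a refl with trans (sym a~a) (irrefl G a)
  ... | ()

  infixr 5 _++_
  _++_ : Walk G a b j → Walk G b c k → Walk G a c (j + k)
  here _   ++ q = q
  step e p ++ q = step e (p ++ q)

  infixl 5 _∷ʳ_
  _∷ʳ_ : Walk G a b j → b ~ c → Walk G a c (suc j)
  here _   ∷ʳ e = step e (here _)
  step e p ∷ʳ f = step e (p ∷ʳ f)

  reverse : Walk G a b j → Walk G b a j
  reverse (here a)   = here a
  reverse (step e p) = reverse p ∷ʳ ~-sym e

  splitAt : ∀ i {k} → Walk G a c (i + k) → ∃ λ b → Walk G a b i × Walk G b c k
  splitAt zero    p          = _ , here _ , p
  splitAt (suc i) (step e p) with splitAt i p
  ... | b , p₁ , p₂ = b , step e p₁ , p₂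

  reach-suc : T (reach G k a b) → T (reach G (suc k) a b)
  reach-suc {k} {a} {b} r with reach G k a b
  ... | true = tt

  reach-step : a ~ c → T (reach G k c b) → T (reach G (suc k) a b)
  reach-step {a} {c} {k} {b} a~c r with reach G k a b
  ... | true  = tt
  ... | false = any⁺ (λ c → adj G a c ∧ reach G k c b)
                  (lose (∈-allFin c) (subst (λ t → T (t ∧ reach G k c b)) (sym a~c) r))

  reach-complete : Walk G a b j → j ≤ k → T (reach G k a b)
  reach-complete {k = zero}  (here a)   z≤n       = fromWitness refl
  reach-complete {k = suc k} (here a) _ = reach-suc {k = k} {a = a} {b = a} (reach-complete {k = k} (here a) z≤n)
  reach-complete {b = b} {k = suc k} (step e p) (s≤s j≤k) = reach-step {k = k} {b = b} e (reach-complete p j≤k)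

  reach-sound : T (reach G k a b) → ∃ λ j → j ≤ k × Walk G a b j
  reach-sound {zero} {a} r = 0 , z≤n , subst (λ b → Walk G a b 0) (toWitness r) (here a)
  reach-sound {suc k} {a} {b} r with reach G k a b in eq
  ... | true with reach-sound (subst T (sym eq) tt)
  ...   | j , j≤k , p = j , m≤n⇒m≤1+n j≤k , p
  reach-sound {suc k} {a} {b} r | false with satisfied (any⁻ (λ c → adj G a c ∧ reach G k c b) (allFin (n G)) r)
  ... | c , t with adj G a c in a~c
  ...   | true with reach-sound t
  ...     | j , j≤k , p = suc j , s≤s j≤k , step a~c p

  Within : ℕ → V → V → Set
  Within k a b = ∃ λ j → j ≤ k × Walk G a b j

  within? : ∀ k a b → Dec (Within k a b)
  within? k a b = map′ reach-sound (λ (_ , j≤k , p) → reach-complete p j≤k) (T? (reach G k a b))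

-- Defs computes dist by a fuel-(n G) search through a private helper, which unfolds only through
-- a numeral prefix of n G. Unfolding eight steps shows that dist is the walk distance whenever
-- the latter is below 8; this is why several statements below assume 8 ≤ n G.
firstReach : (G : Graph) → (fuel start fallback : ℕ) → Fin (n G) → Fin (n G) → ℕ
firstReach G zero    k s a b = s
firstReach G (suc f) k s a b = if reach G k a b then k else firstReach G f (suc k) s a b

dist-unfold : (G : Graph) → 8 ≤ n G → ∀ a b → ∃ λ s → dist G a b ≡ firstReach G 8 0 s a b
dist-unfold record { n = suc (suc (suc (suc (suc (suc (suc (suc _))))))) }
  (s≤s (s≤s (s≤s (s≤s (s≤s (s≤s (s≤s (s≤s _)))))))) a b = _ , refl

DiameterBelow : ℕ → Graph → Set
DiameterBelow k G = ∀ x y → ∃ λ j → j < k × Walk G x y j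

record ExactDist (G : Graph) : Set where
  field
    dist≤    : ∀ {x y j} → Walk G x y j → dist G x y ≤ j
    geodesic : ∀ x y → Walk G x y (dist G x y)

module _ {G : Graph} where
  open Walks G

  private
    variable
      a b : V

  firstReach-hit : ∀ f k s j → k ≤ j → j < k + f → T (reach G j a b) →
                   firstReach G f k s a b ≤ j × T (reach G (firstReach G f k s a b) a b)
  firstReach-hit zero k s j k≤j j<k+0 r =
    contradiction (≤-trans j<k+0 (≤-trans (≤-reflexive (+-identityʳ k)) k≤j)) (n≮n j)
  firstReach-hit {a} {b} (suc f) k s j k≤j j<k+f r with reach G k a b in eq
  ... | true  = k≤j , subst T (sym eq) tt
  ... | false = firstReach-hit f (suc k) s j (≤∧≢⇒< k≤j k≢j) (subst (j <_) (+-suc k f) j<k+f) r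
    where
    k≢j : k ≢ j
    k≢j refl = subst T eq r

  dist-below8 : 8 ≤ n G → Walk G a b j → j < 8 → dist G a b ≤ j × Walk G a b (dist G a b)
  dist-below8 {a} {b} {j} 8≤n p j<8 with dist-unfold G 8≤n a b
  ... | s , eq rewrite eq with firstReach-hit 8 0 s j z≤n j<8 (reach-complete p ≤-refl)
  ...   | d≤j , r with reach-sound r
  ...     | j′ , j′≤d , q = d≤j , subst (Walk G a b) (≤-antisym j′≤d d≤j′) q
    where
    d≤j′ = proj₁ (firstReach-hit 8 0 s j′ z≤n (≤-<-trans j′≤d (≤-<-trans d≤j j<8))
                                  (reach-complete q ≤-refl))

exactDist : {G : Graph} → 8 ≤ n G → DiameterBelow 8 G → ExactDist G
exactDist {G} 8≤n diam = record { dist≤ = dist≤ ; geodesic = λ x y → proj₂ (short x y) }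
  where
  short : ∀ x y → dist G x y ≤ proj₁ (diam x y) × Walk G x y (dist G x y)
  short x y = let (j , j<8 , p) = diam x y in dist-below8 8≤n p j<8
  dist≤ : ∀ {x y j} → Walk G x y j → dist G x y ≤ j
  dist≤ {x} {y} {j} p with j <? 8
  ... | yes j<8 = proj₁ (dist-below8 8≤n p j<8)
  ... | no  j≮8 = ≤-trans (proj₁ (short x y)) (≤-trans (<⇒≤ (proj₁ (proj₂ (diam x y)))) (≮⇒≥ j≮8))

<ᵇ-true : ∀ {p q} → p < q → (p <ᵇ q) ≡ true
<ᵇ-true {p} {q} = Equivalence.to (T-≡ {p <ᵇ q}) ∘ <⇒<ᵇ

<ᵇ-false : ∀ {p q} → q ≤ p → (p <ᵇ q) ≡ false
<ᵇ-false {p} {q} q≤p with p <ᵇ q in eq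
... | false = refl
... | true  = contradiction (<ᵇ⇒< p q (subst T (sym eq) _)) (≤⇒≯ q≤p)

<ᵇ-sound : ∀ {p q} → (p <ᵇ q) ≡ true → p < q
<ᵇ-sound {p} {q} e = <ᵇ⇒< p q (Equivalence.from (T-≡ {p <ᵇ q}) e)

+𝟙<ᵇ-swap : ∀ p q → p ≤ suc q → q ≤ suc p → q + 𝟙 (q <ᵇ p) ≡ p + 𝟙 (p <ᵇ q)
+𝟙<ᵇ-swap zero          zero          _         _         = refl
+𝟙<ᵇ-swap zero          (suc zero)    _         _         = refl
+𝟙<ᵇ-swap (suc zero)    zero          _         _         = refl
+𝟙<ᵇ-swap (suc p)       (suc q)       (s≤s p≤q) (s≤s q≤p) = cong suc (+𝟙<ᵇ-swap p q p≤q q≤p)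
+𝟙<ᵇ-swap zero          (suc (suc q)) _         (s≤s ())
+𝟙<ᵇ-swap (suc (suc p)) zero          (s≤s ())  _

module _ (G : Graph) where
  open Walks G

  closer : V → V → V → Bool
  closer a b x = dist G x a <ᵇ dist G x b

  W≡count : ∀ a b → W G a b ≡ count (closer a b)
  W≡count a b = length-filterᵇ-tabulate (closer a b) id

  W+W≡∑ : ∀ a b → W G a b + W G b a ≡ ∑[ x < n G ] (𝟙 (closer a b x) + 𝟙 (closer b a x))
  W+W≡∑ a b = trans (cong₂ _+_ (W≡count a b) (W≡count b a))
                    (sym (∑-distrib-+ (𝟙 ∘ closer a b) (𝟙 ∘ closer b a)))

  W+W≤n : ∀ a b → W G a b + W G b a ≤ n G
  W+W≤n a b = begin
    W G a b + W G b a                                  ≡⟨ W+W≡∑ a b ⟩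
    ∑[ x < n G ] (𝟙 (closer a b x) + 𝟙 (closer b a x)) ≤⟨ ∑-mono-≤ {g = λ _ → 1} (λ x → at-most-one (dist G x a) (dist G x b)) ⟩
    ∑[ x < n G ] 1                                     ≡⟨ count-true (n G) ⟩
    n G                                                ∎
    where
    open ≤-Reasoning
    at-most-one : ∀ p q → 𝟙 (p <ᵇ q) + 𝟙 (q <ᵇ p) ≤ 1
    at-most-one zero    zero    = z≤n
    at-most-one zero    (suc q) = s≤s z≤n
    at-most-one (suc p) zero    = s≤s z≤n
    at-most-one (suc p) (suc q) = at-most-one p q

module Metric (G : Graph) (E : ExactDist G) where
  open Walks G
  open ExactDist E public

  d : V → V → ℕ
  d = dist G

  private
    variable
      a b c x y : V

  d-refl : ∀ x → d x x ≡ 0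
  d-refl x = n≤0⇒n≡0 (dist≤ (here x))

  d≡0⇒≡ : d x y ≡ 0 → x ≡ y
  d≡0⇒≡ {x} {y} eq with subst (Walk G x y) eq (geodesic x y)
  ... | here _ = refl

  d≡1⇒~ : d x y ≡ 1 → x ~ y
  d≡1⇒~ {x} {y} eq with subst (Walk G x y) eq (geodesic x y)
  ... | step x~y (here _) = x~y

  ~⇒d≡1 : x ~ y → d x y ≡ 1
  ~⇒d≡1 {x} {y} x~y with d x y in eq | dist≤ (step x~y (here y))
  ... | zero  | _       = contradiction (d≡0⇒≡ eq) (~-irrefl x~y)
  ... | suc _ | s≤s z≤n = refl

  d-sym : ∀ x y → d x y ≡ d y x
  d-sym x y = ≤-antisym (dist≤ (reverse (geodesic y x))) (dist≤ (reverse (geodesic x y)))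

  d-~ʳ : ∀ x → b ~ c → d x c ≤ suc (d x b)
  d-~ʳ x b~c = dist≤ (geodesic x _ ∷ʳ b~c)

  d-~ˡ : ∀ x → b ~ c → d b x ≤ suc (d c x)
  d-~ˡ x b~c = dist≤ (step b~c (geodesic _ x))

  d-step : ∀ {m} → d x y ≡ suc m → ∃ λ w → x ~ w × d w y ≡ m
  d-step {x} {y} {m} eq with subst (Walk G x y) eq (geodesic x y)
  ... | step {b = w} x~w p = w , x~w , ≤-antisym (dist≤ p)
                                        (≤-pred (subst (_≤ suc (d w y)) eq (dist≤ (step x~w (geodesic w y)))))

  ≢⇒d≡suc : x ≢ y → ∃ λ m → d x y ≡ suc m
  ≢⇒d≡suc {x} {y} x≢y with d x y in eq
  ... | zero  = contradiction (d≡0⇒≡ eq) x≢y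
  ... | suc m = m , refl

  transmission : V → ℕ
  transmission v = ∑[ x < n G ] d x v

  transmission-W : a ~ b → transmission b + W G b a ≡ transmission a + W G a b
  transmission-W {a} {b} a~b = begin
    transmission b + W G b a                        ≡⟨ cong (transmission b +_) (W≡count G b a) ⟩
    transmission b + count (closer G b a)           ≡⟨ ∑-distrib-+ (λ x → d x b) (𝟙 ∘ closer G b a) ⟨
    ∑[ x < n G ] (d x b + 𝟙 (closer G b a x))       ≡⟨ sum-cong-≗ (λ x → +𝟙<ᵇ-swap (d x a) (d x b) (d-~ʳ x (~-sym a~b)) (d-~ʳ x a~b)) ⟩
    ∑[ x < n G ] (d x a + 𝟙 (closer G a b x))       ≡⟨ ∑-distrib-+ (λ x → d x a) (𝟙 ∘ closer G a b) ⟩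
    transmission a + count (closer G a b)           ≡⟨ cong (transmission a +_) (W≡count G a b) ⟨
    transmission a + W G a b                        ∎
    where open ≡-Reasoning

  module Bipartite (colour : V → Bool) (proper : ∀ {a b} → a ~ b → colour b ≡ not (colour a)) where

    colour-walk : ∀ {j} → Walk G x y j → colour y ≡ iterate not (colour x) j
    colour-walk (here _)       = refl
    colour-walk (step {k = j} x~w p) = trans (colour-walk p) (cong (λ c → iterate not c j) (proper x~w))

    no-triangle : a ~ b → b ~ c → ¬ (a ~ c)
    no-triangle a~b b~c a~c =
      not-¬ (trans (proper b~c) (trans (cong not (proper a~b)) (not-involutive _))) (proper a~c)

    d-~-≢ : ∀ x → a ~ b → d x a ≢ d x b
    d-~-≢ x a~b eq = not-¬ (trans (colour-walk (geodesic x _)) (trans (cong (iterate not (colour x)) (sym eq))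
                           (sym (colour-walk (geodesic x _))))) (proper a~b)

    d-~-dichotomy : ∀ x → a ~ b → d x b ≡ suc (d x a) ⊎ d x a ≡ suc (d x b)
    d-~-dichotomy {a} {b} x a~b with ≤-total (d x a) (d x b)
    ... | inj₁ a≤b = inj₁ (≤-antisym (d-~ʳ x a~b) (≤∧≢⇒< a≤b (d-~-≢ x a~b)))
    ... | inj₂ b≤a = inj₂ (≤-antisym (d-~ʳ x (~-sym a~b)) (≤∧≢⇒< b≤a (d-~-≢ x a~b ∘ sym)))

    W+W≡n : a ~ b → W G a b + W G b a ≡ n G
    W+W≡n {a} {b} a~b = begin
      W G a b + W G b a                                        ≡⟨ W+W≡∑ G a b ⟩
      ∑[ x < n G ] (𝟙 (closer G a b x) + 𝟙 (closer G b a x))   ≡⟨ sum-cong-≗ exactly-one ⟩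
      ∑[ x < n G ] 1                                           ≡⟨ count-true (n G) ⟩
      n G                                                      ∎
      where
      open ≡-Reasoning
      exactly-one : ∀ x → 𝟙 (closer G a b x) + 𝟙 (closer G b a x) ≡ 1
      exactly-one x with d-~-dichotomy x a~b
      ... | inj₁ eq rewrite eq | <ᵇ-true (n<1+n (d x a)) | <ᵇ-false (n≤1+n (d x a)) = refl
      ... | inj₂ eq rewrite eq | <ᵇ-true (n<1+n (d x b)) | <ᵇ-false (n≤1+n (d x b)) = refl

    closer⇒d≡suc : a ~ b → closer G b a x ≡ true → d x a ≡ suc (d x b)
    closer⇒d≡suc {x = x} a~b x-closer with d-~-dichotomy x a~b
    ... | inj₁ eq = contradiction (<ᵇ-sound x-closer) (≤⇒≯ (≤-trans (n≤1+n _) (≤-reflexive (sym eq))))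
    ... | inj₂ eq = eq

    common-neighbour⇒d≡2 : a ~ x → a ~ y → x ≢ y → d x y ≡ 2
    common-neighbour⇒d≡2 {a} {x} {y} a~x a~y x≢y with d-~-dichotomy x a~y
    ... | inj₁ eq = trans eq (cong suc (~⇒d≡1 (~-sym a~x)))
    ... | inj₂ eq = contradiction (d≡0⇒≡ (suc-injective (trans (sym eq) (~⇒d≡1 (~-sym a~x))))) x≢y

W-bound : ∀ {G γ} → Is3GNDBWith G γ → ∀ {a b} → adj G a b ≡ true → W G b a ≤ 3 * γ
W-bound gndb {a} {b} a~b with gndb a b a~b
... | inj₁ (_ , Wba≡γ)       = ≤-trans (≤-reflexive Wba≡γ) (m≤n*m _ 3)
... | inj₂ (Wba≡3Wab , Wab≡γ) = ≤-reflexive (trans Wba≡3Wab (cong (3 *_) Wab≡γ))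

module _ {G : Graph} where
  open Walks G

  private
    variable
      x y z : V

  ball-boundary : Within k x y → Walk G y z j → ¬ Within k x z →
                  ∃₂ λ a b → a ~ b × Within k x a × ¬ Within k x b
  ball-boundary y∈B (here _) z∉B = contradiction y∈B z∉B
  ball-boundary {k} {x} y∈B (step {b = y′} y~y′ p) z∉B with within? k x y′
  ... | yes y′∈B = ball-boundary y′∈B p z∉B
  ... | no  y′∉B = _ , y′ , y~y′ , y∈B , y′∉B

  sphere : ∀ k → Walk G x y j → ¬ Within k x y → ∃ λ z → Walk G x z (suc k) × ¬ Within k x z
  sphere {x} k p y∉B with ball-boundary (0 , z≤n , here x) p y∉B
  ... | a , z , a~z , (j , j≤k , q) , z∉B = z , subst (Walk G x z ∘ suc) (≤-antisym j≤k k≤j) (q ∷ʳ a~z) , z∉B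
    where
    k≤j : k ≤ j
    k≤j = ≤-pred (≰⇒> (λ 1+j≤k → z∉B (suc j , 1+j≤k , q ∷ʳ a~z)))

  module _ (8≤n : 8 ≤ n G) where

    dist-exact : Walk G x y j → j < 8 → (∀ {m} → Walk G x y m → j ≤ m) → dist G x y ≡ j
    dist-exact p j<8 shortest with dist-below8 8≤n p j<8
    ... | d≤j , q = ≤-antisym d≤j (shortest q)

    -- the i-th vertex of the walk y → ⋯ → z is at distance i from y and i + 1 from x
    shortest⇒W≥ : x ~ y → Walk G y z k → suc k < 8 → (∀ {m} → Walk G x z m → suc k ≤ m) → suc k ≤ W G y x
    shortest⇒W≥ {x} {v} {z} {k} x~v w k<8 shortest =
      subst (suc k ≤_) (sym (W≡count G v x)) (injection≤count vertex vertex-injective vertex-closer)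
      where
      module _ (i : Fin (suc k)) where
        i≤k : toℕ i ≤ k
        i≤k = ≤-pred (toℕ<n i)
        rest : ∃ λ r → toℕ i + r ≡ k
        rest = m≤n⇒∃[o]m+o≡n i≤k
        r = proj₁ rest
        split = splitAt (toℕ i) (subst (Walk G v z) (sym (proj₂ rest)) w)
        vertex = proj₁ split
        p₁ = proj₁ (proj₂ split)
        p₂ = proj₂ (proj₂ split)
        shortest′ : ∀ {m} → Walk G x z (m + r) → toℕ i + r < m + r
        shortest′ {m} q = subst (_≤ m + r) (cong suc (sym (proj₂ rest))) (shortest q)
        d-vertex-v : dist G vertex v ≡ toℕ i
        d-vertex-v = dist-exact (reverse p₁) (≤-<-trans i≤k (≤-trans (n≤1+n _) k<8))
                  (λ q → +-cancelʳ-≤ r _ _ (≤-pred (shortest′ (step x~v (reverse q) ++ p₂))))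
        d-vertex-x : dist G vertex x ≡ suc (toℕ i)
        d-vertex-x = dist-exact (reverse (step x~v p₁)) (s≤s (≤-<-trans i≤k (≤-pred k<8)))
                  (λ q → +-cancelʳ-≤ r _ _ (shortest′ (reverse q ++ p₂)))
      vertex-injective : ∀ {i j} → vertex i ≡ vertex j → i ≡ j
      vertex-injective {i} {j} vi≡vj =
        toℕ-injective (trans (sym (d-vertex-v i)) (trans (cong (λ y → dist G y v) vi≡vj) (d-vertex-v j)))
      vertex-closer : ∀ i → closer G v x (vertex i) ≡ true
      vertex-closer i = <ᵇ-true (subst₂ _<_ (sym (d-vertex-v i)) (sym (d-vertex-x i)) ≤-refl)

  diameterBelow8 : Connected G → 8 ≤ n G → Is3GNDBWith G 2 → DiameterBelow 8 G
  diameterBelow8 conn 8≤n gndb x y with within? 7 x y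
  ... | yes (j , j≤7 , p) = j , s≤s j≤7 , p
  ... | no  y∉B with sphere 6 (proj₂ (conn x y)) (λ (j , j≤6 , p) → y∉B (j , m≤n⇒m≤1+n j≤6 , p))
  ...   | z , step x~v w , z∉B =
    contradiction (shortest⇒W≥ 8≤n x~v w ≤-refl (λ q → ≰⇒> (λ m≤6 → z∉B (_ , m≤6 , q))))
                  (≤⇒≯ (W-bound gndb x~v))

record CompleteBipartite (G : Graph) (P : Fin (n G) → Bool) : Set where
  field
    adj≡xor : ∀ x y → adj G x y ≡ P x xor P y
open CompleteBipartite public

module _ {G : Graph} {P : Fin (n G) → Bool} where
  open Walks G

  completeBipartite-intro : (∀ {x y} → P x ≡ P y → ¬ x ~ y) →
                            (∀ {x y} → P x ≡ true → P y ≡ false → x ~ y) →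
                            CompleteBipartite G P
  completeBipartite-intro same-side across = record { adj≡xor = adj≡ }
    where
    adj≡ : ∀ x y → adj G x y ≡ P x xor P y
    adj≡ x y with P x in Px | P y in Py
    ... | true  | true  = ¬-not (same-side (trans Px (sym Py)))
    ... | true  | false = across Px Py
    ... | false | true  = ~-sym (across Py Px)
    ... | false | false = ¬-not (same-side (trans Px (sym Py)))

module _ {G : Graph} {P : Fin (n G) → Bool} (cb : CompleteBipartite G P) where
  open Walks G

  private
    variable
      x y : V

  complement : CompleteBipartite G (not ∘ P)
  complement = record { adj≡xor = adj≡ }
    where
    adj≡ : ∀ x y → adj G x y ≡ not (P x) xor not (P y)
    adj≡ x y with P x | P y | adj≡xor cb x y
    ... | true  | true  | e = e
    ... | true  | false | e = e
    ... | false | true  | e = e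
    ... | false | false | e = e

  across⇒~ : P x ≢ P y → x ~ y
  across⇒~ {x} {y} Px≢Py = trans (adj≡xor cb x y) (trans (cong (P x xor_) (¬-not (Px≢Py ∘ sym))) (xor-inverseʳ (P x)))

  same⇒≁ : P x ≡ P y → ¬ x ~ y
  same⇒≁ {x} {y} Px≡Py x~y
    with trans (sym x~y) (trans (adj≡xor cb x y) (trans (cong (P x xor_) (sym Px≡Py)) (xor-same (P x))))
  ... | ()

  module _ {a b : V} (Pa : P a ≡ true) (Pb : P b ≡ false) where

    opposite : V → V
    opposite x = if P x then b else a

    P-opposite : ∀ x → P (opposite x) ≡ not (P x)
    P-opposite x with P x
    ... | true  = Pb
    ... | false = Pa

    ~opposite : ∀ x → x ~ opposite x
    ~opposite x = across⇒~ (λ e → not-¬ refl (trans e (P-opposite x)))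

    two-step : P x ≡ P y → Walk G x y 2
    two-step {x} {y} Px≡Py = step (~opposite x) (step opposite~y (here y))
      where
      opposite~y : opposite x ~ y
      opposite~y = across⇒~ (λ e → not-¬ (sym Px≡Py) (trans (sym e) (P-opposite x)))

    complete-diameterBelow8 : DiameterBelow 8 G
    complete-diameterBelow8 x y with P x ≟ᵇ P y
    ... | no  Px≢Py = 1 , s≤s (s≤s z≤n) , step (across⇒~ Px≢Py) (here y)
    ... | yes Px≡Py = 2 , s≤s (s≤s (s≤s z≤n)) , two-step Px≡Py

  W-across : 8 ≤ n G → ∀ {a b} → P a ≡ true → P b ≡ false → W G a b ≡ count (not ∘ P)
  W-across 8≤n {a} {b} Pa Pb = +-cancelʳ-≡ 1 _ _ (begin
    W G a b + 1                                       ≡⟨ cong₂ _+_ (W≡count G a b) (sym (count-≟ b)) ⟩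
    count (closer G a b) + count (λ z → ⌊ z ≟ b ⌋)    ≡⟨ ∑-distrib-+ (𝟙 ∘ closer G a b) (λ z → 𝟙 ⌊ z ≟ b ⌋) ⟨
    ∑[ z < n G ] (𝟙 (closer G a b z) + 𝟙 ⌊ z ≟ b ⌋)  ≡⟨ sum-cong-≗ split ⟩
    ∑[ z < n G ] (𝟙 ⌊ z ≟ a ⌋ + 𝟙 (not (P z)))        ≡⟨ ∑-distrib-+ (λ z → 𝟙 ⌊ z ≟ a ⌋) (𝟙 ∘ not ∘ P) ⟩
    count (λ z → ⌊ z ≟ a ⌋) + count (not ∘ P)         ≡⟨ cong (_+ count (not ∘ P)) (count-≟ a) ⟩
    1 + count (not ∘ P)                               ≡⟨ +-comm 1 _ ⟩
    count (not ∘ P) + 1                               ∎)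
    where
    open ≡-Reasoning
    open Metric G (exactDist 8≤n (complete-diameterBelow8 Pa Pb))
    d-across : P x ≢ P y → d x y ≡ 1
    d-across = ~⇒d≡1 ∘ across⇒~
    d-same : x ≢ y → P x ≡ P y → d x y ≡ 2
    d-same {x} {y} x≢y Px≡Py with d x y in eq | dist≤ (two-step Pa Pb Px≡Py)
    ... | 0     | _ = contradiction (d≡0⇒≡ eq) x≢y
    ... | 1     | _ = contradiction (d≡1⇒~ eq) (same⇒≁ Px≡Py)
    ... | 2     | _ = refl
    ... | suc (suc (suc _)) | s≤s (s≤s ())
    true≢false : ∀ {x y} → P x ≡ true → P y ≡ false → P x ≢ P y
    true≢false Px Py e = contradiction (trans (sym Px) (trans e Py)) λ ()
    indicators : ∀ {p q p′ q′} → p ≡ p′ → q ≡ q′ → 𝟙 p + 𝟙 q ≡ 𝟙 p′ + 𝟙 q′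
    indicators refl refl = refl
    split : ∀ z → 𝟙 (closer G a b z) + 𝟙 ⌊ z ≟ b ⌋ ≡ 𝟙 ⌊ z ≟ a ⌋ + 𝟙 (not (P z))
    split z with z ≟ a | z ≟ b
    ... | yes refl | yes refl = contradiction refl (true≢false Pa Pb)
    ... | yes refl | no _ = indicators (<ᵇ-true (subst₂ _<_ (sym (d-refl z)) (sym (d-across (true≢false Pa Pb))) (s≤s z≤n)))
                                       (sym (cong not Pa))
    ... | no _ | yes refl = indicators (<ᵇ-false (subst (_≤ d z a) (sym (d-refl z)) z≤n)) (sym (cong not Pb))
    ... | no z≢a | no z≢b with P z in Pz
    ...   | true  = indicators (<ᵇ-false (subst₂ _≤_ (sym (d-across (true≢false Pz Pb))) (sym (d-same z≢a (trans Pz (sym Pa))))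
                                                   (s≤s z≤n))) refl
    ...   | false = cong (λ t → 𝟙 t + 0) (<ᵇ-true (subst₂ _<_ (sym (d-across (true≢false Pa Pz ∘ sym)))
                                                                  (sym (d-same z≢b (trans Pz (sym Pb)))) ≤-refl))

across-3GNDB : ∀ {G P} → CompleteBipartite G P → 8 ≤ n G → count P ≡ 2 → count (not ∘ P) ≡ 6 →
               ∀ {x y} → P x ≡ true → P y ≡ false → W G x y ≡ 3 * W G y x × W G y x ≡ 2
across-3GNDB {G} {P} cb 8≤n #P≡2 #¬P≡6 Px Py = trans Wxy≡6 (cong (3 *_) (sym Wyx≡2)) , Wyx≡2
  where
  Wxy≡6 = trans (W-across cb 8≤n Px Py) #¬P≡6
  Wyx≡2 = trans (W-across (complement cb) 8≤n (cong not Py) (cong not Px))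
                (trans (count-cong (not-involutive ∘ P)) #P≡2)

completeBipartite⇒3GNDB : ∀ {G P} → 8 ≤ n G → CompleteBipartite G P → count P ≡ 2 → count (not ∘ P) ≡ 6 →
                          Is3GNDBWith G 2
completeBipartite⇒3GNDB {G} {P} 8≤n cb #P≡2 #¬P≡6 a b a~b with P a in Pa | P b in Pb
... | true  | true  = contradiction a~b (same⇒≁ cb (trans Pa (sym Pb)))
... | false | false = contradiction a~b (same⇒≁ cb (trans Pa (sym Pb)))
... | true  | false = inj₁ (across-3GNDB cb 8≤n #P≡2 #¬P≡6 Pa Pb)
... | false | true  = inj₂ (across-3GNDB cb 8≤n #P≡2 #¬P≡6 Pb Pa)

oddQuarter : ℕ → Bool
oddQuarter (suc (suc (suc (suc t)))) = not (oddQuarter t)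
oddQuarter _                         = false

module _ {G : Graph} (gndb : Is3GNDBWith G 2) where
  open Walks G

  private
    variable
      a b : V

  W-sides : a ~ b → (W G a b ≡ 6 × W G b a ≡ 2) ⊎ (W G b a ≡ 6 × W G a b ≡ 2)
  W-sides {a} {b} a~b with gndb a b a~b
  ... | inj₁ (Wab≡3Wba , Wba≡2) = inj₁ (trans Wab≡3Wba (cong (3 *_) Wba≡2) , Wba≡2)
  ... | inj₂ (Wba≡3Wab , Wab≡2) = inj₂ (trans Wba≡3Wab (cong (3 *_) Wab≡2) , Wab≡2)

  3GNDB₂⇒8≤n : a ~ b → 8 ≤ n G
  3GNDB₂⇒8≤n {a} {b} a~b with W-sides a~b
  ... | inj₁ (Wab≡6 , Wba≡2) = subst (_≤ n G) (cong₂ _+_ Wab≡6 Wba≡2) (W+W≤n G a b)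
  ... | inj₂ (Wba≡6 , Wab≡2) = subst (_≤ n G) (cong₂ _+_ Wab≡2 Wba≡6) (W+W≤n G a b)

module GNDB₂ (G : Graph) (E : ExactDist G) (gndb : Is3GNDBWith G 2) where
  open Walks G
  open Metric G E

  private
    variable
      a b c x y : V

  W-small⇒W-big : a ~ b → W G b a ≡ 2 → W G a b ≡ 6
  W-small⇒W-big a~b Wba≡2 with W-sides gndb a~b
  ... | inj₁ (Wab≡6 , _)     = Wab≡6
  ... | inj₂ (Wba≡6 , _)     = contradiction (trans (sym Wba≡6) Wba≡2) λ ()

  transmission-small : a ~ b → W G b a ≡ 2 → transmission b ≡ 4 + transmission a
  transmission-small {a} {b} a~b Wba≡2 = +-cancelʳ-≡ 2 _ _ (begin
    transmission b + 2       ≡⟨ cong (transmission b +_) Wba≡2 ⟨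
    transmission b + W G b a ≡⟨ transmission-W a~b ⟩
    transmission a + W G a b ≡⟨ cong (transmission a +_) (W-small⇒W-big a~b Wba≡2) ⟩
    transmission a + 6       ≡⟨ +-comm (transmission a) 6 ⟩
    6 + transmission a       ≡⟨ cong (4 +_) (+-comm 2 (transmission a)) ⟩
    4 + transmission a + 2   ∎)
    where open ≡-Reasoning

  -- adjacent transmissions differ by exactly 4, so bit 2 of the transmission alternates along edges
  colour : V → Bool
  colour = oddQuarter ∘ transmission

  colour-proper : a ~ b → colour b ≡ not (colour a)
  colour-proper {a} {b} a~b with W-sides gndb a~b
  ... | inj₁ (_ , Wba≡2) = cong oddQuarter (transmission-small a~b Wba≡2)
  ... | inj₂ (_ , Wab≡2) = trans (sym (not-involutive (colour b)))
                                 (cong not (sym (cong oddQuarter (transmission-small (~-sym a~b) Wab≡2))))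

  open Bipartite colour colour-proper

  n≡8 : a ~ b → n G ≡ 8
  n≡8 a~b with W-sides gndb a~b
  ... | inj₁ (Wab≡6 , Wba≡2) = trans (sym (W+W≡n a~b)) (cong₂ _+_ Wab≡6 Wba≡2)
  ... | inj₂ (Wba≡6 , Wab≡2) = trans (sym (W+W≡n a~b)) (cong₂ _+_ Wab≡2 Wba≡6)

  record Partner (a b c : V) : Set where
    field
      adjacent : b ~ c
      dist≡2   : d c a ≡ 2
      closer⇒  : ∀ x → closer G b a x ≡ true → x ≡ b ⊎ x ≡ c

  -- opaque: with-abstracting over an unfolded partner makes Agda normalise its whole proof
  opaque
    partner : a ~ b → W G b a ≡ 2 → ∃ (Partner a b)
    partner {a} {b} a~b Wba≡2 with count≡2 b b-closer (trans (sym (W≡count G b a)) Wba≡2)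
      where
      b-closer : closer G b a b ≡ true
      b-closer = <ᵇ-true (subst₂ _<_ (sym (d-refl b)) (sym (~⇒d≡1 (~-sym a~b))) ≤-refl)
    ... | c , c≢b , c-closer , cover with ≢⇒d≡suc c≢b
    ...   | m , dcb≡1+m with d-step dcb≡1+m
    ...     | w , c~w , dwb≡m with cover w (<ᵇ-true w-closer)
      where
      dca≡2+m : d c a ≡ suc (suc m)
      dca≡2+m = trans (closer⇒d≡suc a~b c-closer) (cong suc dcb≡1+m)
      w-closer : d w b < d w a
      w-closer = subst (_< d w a) (sym dwb≡m) (≤-pred (subst (_≤ suc (d w a)) dca≡2+m (d-~ˡ a c~w)))
    ...       | inj₂ refl = contradiction refl (~-irrefl c~w)
    ...       | inj₁ refl = c , record
      { adjacent = ~-sym c~w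
      ; dist≡2   = trans (closer⇒d≡suc a~b c-closer) (cong suc (~⇒d≡1 c~w))
      ; closer⇒  = cover
      }

  module Hub (v₀ : V) where

    opaque
      h : V
      h = argmin transmission v₀ (allFin (n G))

      h-min : ∀ x → transmission h ≤ transmission x
      h-min x = lookup (f[argmin]≤f[xs] v₀ (allFin (n G))) (∈-allFin x)

    hub-small : h ~ b → W G b h ≡ 2
    hub-small {b} h~b with W-sides gndb h~b
    ... | inj₁ (_ , Wbh≡2) = Wbh≡2
    ... | inj₂ (_ , Whb≡2) = contradiction (h-min b)
                               (<⇒≱ (subst (transmission b <_) (sym (transmission-small (~-sym h~b) Whb≡2))
                                              (m<n+m _ (s≤s z≤n))))

    near-h : ∀ x → x ≢ h → h ~ x ⊎ ∃ λ b → h ~ b × Partner h b x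
    near-h x x≢h with ≢⇒d≡suc (x≢h ∘ sym)
    ... | m , dhx≡1+m with d-step dhx≡1+m
    ...   | b , h~b , dbx≡m with partner h~b (hub-small h~b)
    ...     | c , P with Partner.closer⇒ P x (<ᵇ-true x-closer)
      where
      x-closer : d x b < d x h
      x-closer = subst₂ _<_ (trans (sym dbx≡m) (d-sym b x)) (trans (sym dhx≡1+m) (d-sym h x)) ≤-refl
    ...       | inj₁ refl = inj₁ h~b
    ...       | inj₂ refl = inj₂ (b , h~b , P)

    module SecondHub {b c} (h~b : h ~ b) (b~c : b ~ c) (dch≡2 : d c h ≡ 2) (Wbc≡2 : W G b c ≡ 2) where

      dcb≡1 : d c b ≡ 1
      dcb≡1 = ~⇒d≡1 (~-sym b~c)

      W-bh⊆ : ∀ x → closer G b h x ≡ true → x ≡ b ⊎ x ≡ c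
      W-bh⊆ x x-closer with partner h~b (hub-small h~b)
      ... | c′ , P with Partner.closer⇒ P c (<ᵇ-true (subst₂ _<_ (sym dcb≡1) (sym dch≡2) ≤-refl))
      ...   | inj₁ c≡b  = contradiction c≡b (~-irrefl (~-sym b~c))
      ...   | inj₂ refl = Partner.closer⇒ P x x-closer

      W-bc⊆ : ∀ x → closer G b c x ≡ true → x ≡ b ⊎ x ≡ h
      W-bc⊆ x x-closer with partner (~-sym b~c) Wbc≡2
      ... | h′ , P with Partner.closer⇒ P h (<ᵇ-true h-closer)
        where
        h-closer : d h b < d h c
        h-closer = subst₂ _<_ (sym (~⇒d≡1 h~b)) (sym (trans (d-sym h c) dch≡2)) ≤-refl
      ...   | inj₁ h≡b  = contradiction h≡b (~-irrefl h~b)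
      ...   | inj₂ refl = Partner.closer⇒ P x x-closer

      d-b≡1+d-c : ∀ x → x ≢ b → x ≢ h → d x b ≡ suc (d x c)
      d-b≡1+d-c x x≢b x≢h with d-~-dichotomy x b~c
      ... | inj₂ eq = eq
      ... | inj₁ eq with W-bc⊆ x (<ᵇ-true (subst (d x b <_) (sym eq) ≤-refl))
      ...   | inj₁ x≡b = contradiction x≡b x≢b
      ...   | inj₂ x≡h = contradiction x≡h x≢h

      spoke : ∀ x → x ≢ h → x ≢ c → h ~ x × c ~ x
      spoke x x≢h x≢c with x ≟ b
      ... | yes refl = h~b , ~-sym b~c
      ... | no  x≢b with near-h x x≢h
      ...   | inj₁ h~x = h~x , ~-sym (d≡1⇒~ (suc-injective dx-b))
        where
        dx-b : suc (d x c) ≡ 2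
        dx-b = trans (sym (d-b≡1+d-c x x≢b x≢h)) (common-neighbour⇒d≡2 h~x h~b x≢b)
      ...   | inj₂ (b′ , h~b′ , P) with b′ ≟ b
      ...     | yes refl = case (W-bh⊆ x (<ᵇ-true x-closer))
        where
        x-closer : d x b′ < d x h
        x-closer = subst₂ _<_ (sym (~⇒d≡1 (~-sym (Partner.adjacent P)))) (sym (Partner.dist≡2 P)) ≤-refl
        case : x ≡ b′ ⊎ x ≡ c → h ~ x × c ~ x
        case (inj₁ x≡b) = contradiction x≡b x≢b
        case (inj₂ x≡c) = contradiction x≡c x≢c
      ...     | no b′≢b with Partner.closer⇒ P c (<ᵇ-true c-closer)
        where
        db′c≡1 : d b′ c ≡ 1
        db′c≡1 = suc-injective (trans (sym (d-b≡1+d-c b′ b′≢b (~-irrefl h~b′ ∘ sym)))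
                                      (common-neighbour⇒d≡2 h~b′ h~b b′≢b))
        c-closer : d c b′ < d c h
        c-closer = subst₂ _<_ (sym (trans (d-sym c b′) db′c≡1)) (sym dch≡2) ≤-refl
      ...       | inj₁ refl = contradiction (trans (sym dch≡2) (~⇒d≡1 (~-sym h~b′))) λ ()
      ...       | inj₂ c≡x  = contradiction (sym c≡x) x≢c

      complete : CompleteBipartite G (pair h c)
      complete = completeBipartite-intro same-side across
        where
        h≁c : ¬ h ~ c
        h≁c h~c = contradiction (trans (sym dch≡2) (~⇒d≡1 (~-sym h~c))) λ ()
        same-side : ∀ {x y} → pair h c x ≡ pair h c y → ¬ x ~ y
        same-side {x} {y} eq x~y with pair h c x in px
        ... | true with pair-elim {u = h} {c} {x} px | pair-elim {u = h} {c} {y} (sym eq)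
        ...   | inj₁ refl | inj₁ refl = ~-irrefl x~y refl
        ...   | inj₁ refl | inj₂ refl = h≁c x~y
        ...   | inj₂ refl | inj₁ refl = h≁c (~-sym x~y)
        ...   | inj₂ refl | inj₂ refl = ~-irrefl x~y refl
        same-side {x} {y} eq x~y | false with pair-false {u = h} {c} {x} px | pair-false {u = h} {c} {y} (sym eq)
        ...   | x≢h , x≢c | y≢h , y≢c =
          no-triangle x~y (~-sym (proj₁ (spoke y y≢h y≢c))) (~-sym (proj₁ (spoke x x≢h x≢c)))
        across : ∀ {x y} → pair h c x ≡ true → pair h c y ≡ false → x ~ y
        across {x} {y} px py with pair-elim {u = h} {c} {x} px | pair-false {u = h} {c} {y} py
        ... | inj₁ refl | y≢h , y≢c = proj₁ (spoke _ y≢h y≢c)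
        ... | inj₂ refl | y≢h , y≢c = proj₂ (spoke _ y≢h y≢c)

    module NoSecondHub (n≡8 : n G ≡ 8) (outer-small : ∀ {b c} → h ~ b → b ~ c → d c h ≡ 2 → W G c b ≡ 2) where

      isC : V → Bool
      isC x = ⌊ d x h ≟ℕ 2 ⌋

      d≡2⇒≢h : d x h ≡ 2 → x ≢ h
      d≡2⇒≢h {x} dxh≡2 refl = contradiction (trans (sym dxh≡2) (d-refl h)) λ ()

      d≡2⇒≁h : d x h ≡ 2 → ¬ h ~ x
      d≡2⇒≁h dxh≡2 h~x = contradiction (trans (sym dxh≡2) (~⇒d≡1 (~-sym h~x))) λ ()

      layers : ∀ x → x ≡ h ⊎ h ~ x ⊎ d x h ≡ 2
      layers x with x ≟ h
      ... | yes x≡h = inj₁ x≡h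
      ... | no  x≢h with near-h x x≢h
      ...   | inj₁ h~x         = inj₂ (inj₁ h~x)
      ...   | inj₂ (_ , _ , P) = inj₂ (inj₂ (Partner.dist≡2 P))

      degree-C : d c h ≡ 2 → count (adj G c) ≡ 2
      degree-C {c} dch≡2 with near-h c (d≡2⇒≢h dch≡2)
      ... | inj₁ h~c = contradiction h~c (d≡2⇒≁h dch≡2)
      ... | inj₂ (b , h~b , P) with partner (Partner.adjacent P) (outer-small h~b (Partner.adjacent P) dch≡2)
      ...   | u , Q = count≡2-intro b≢u (~-sym b~c) (Partner.adjacent Q) cover
        where
        b~c = Partner.adjacent P
        b≢u : b ≢ u
        b≢u refl = contradiction (trans (sym (Partner.dist≡2 Q)) (d-refl b)) λ ()
        cover : ∀ y → c ~ y → y ≡ b ⊎ y ≡ u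
        cover y c~y with d-~-dichotomy y b~c
        ... | inj₁ eq = inj₁ (d≡0⇒≡ (suc-injective (trans (sym eq) (~⇒d≡1 (~-sym c~y)))))
        ... | inj₂ eq with Partner.closer⇒ Q y (<ᵇ-true (subst (d y c <_) (sym eq) ≤-refl))
        ...   | inj₁ refl = contradiction refl (~-irrefl c~y)
        ...   | inj₂ y≡u  = inj₂ y≡u

      private
        indicators : ∀ {p q r p′ q′ r′} → p ≡ p′ → q ≡ q′ → r ≡ r′ → 𝟙 p + 𝟙 q + 𝟙 r ≡ 𝟙 p′ + 𝟙 q′ + 𝟙 r′
        indicators refl refl refl = refl

      C-neighbours : ∀ y → count (λ x → isC x ∧ adj G y x) ≡ 𝟙 (adj G h y)
      C-neighbours y with layers y
      ... | inj₁ refl = trans (count-cong none) (trans (count-false (n G)) (cong 𝟙 (sym (irrefl G h))))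
        where
        none : ∀ x → (isC x ∧ adj G h x) ≡ false
        none x with isC x in Cx | adj G h x in h~x
        ... | false | _     = refl
        ... | true  | false = refl
        ... | true  | true  = contradiction h~x (d≡2⇒≁h (⌊⌋-sound (d x h ≟ℕ 2) Cx))
      ... | inj₂ (inj₁ h~y) with partner h~y (hub-small h~y)
      ...   | c , P = trans (count≡1-intro C-c unique) (cong 𝟙 (sym h~y))
        where
        C-c : (isC c ∧ adj G y c) ≡ true
        C-c = trans (cong₂ _∧_ (⌊⌋-yes (d c h ≟ℕ 2) (Partner.dist≡2 P)) (Partner.adjacent P)) refl
        unique : ∀ x → (isC x ∧ adj G y x) ≡ true → x ≡ c
        unique x Cx∧y~x with isC x in Cx | adj G y x in y~x
        ... | true | true with Partner.closer⇒ P x (<ᵇ-true x-closer)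
          where
          x-closer : d x y < d x h
          x-closer = subst₂ _<_ (sym (~⇒d≡1 (~-sym y~x))) (sym (⌊⌋-sound (d x h ≟ℕ 2) Cx)) ≤-refl
        ...   | inj₁ refl = contradiction refl (~-irrefl y~x)
        ...   | inj₂ x≡c  = x≡c
      C-neighbours y | inj₂ (inj₂ dyh≡2) =
        trans (count-cong none) (trans (count-false (n G)) (cong 𝟙 (sym (¬-not (d≡2⇒≁h dyh≡2)))))
        where
        none : ∀ x → (isC x ∧ adj G y x) ≡ false
        none x with isC x in Cx | adj G y x in y~x
        ... | false | _     = refl
        ... | true  | false = refl
        ... | true  | true  =
          contradiction (trans (d-sym h y) (trans dyh≡2 (sym (trans (d-sym h x) (⌊⌋-sound (d x h ≟ℕ 2) Cx)))))
                                            (d-~-≢ h y~x)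

      partition : ∀ x → 𝟙 ⌊ x ≟ h ⌋ + 𝟙 (adj G h x) + 𝟙 (isC x) ≡ 1
      partition x with layers x
      ... | inj₁ refl = indicators (⌊⌋-yes (h ≟ h) refl) (irrefl G h)
                          (⌊⌋-no (d h h ≟ℕ 2) (λ e → contradiction (trans (sym e) (d-refl h)) λ ()))
      ... | inj₂ (inj₁ h~x) = indicators (⌊⌋-no (x ≟ h) (~-irrefl h~x ∘ sym)) h~x
                                (⌊⌋-no (d x h ≟ℕ 2) (λ e → contradiction (trans (sym e) (~⇒d≡1 (~-sym h~x))) λ ()))
      ... | inj₂ (inj₂ dxh≡2) = indicators (⌊⌋-no (x ≟ h) (d≡2⇒≢h dxh≡2)) (¬-not (d≡2⇒≁h dxh≡2))
                                  (⌊⌋-yes (d x h ≟ℕ 2) dxh≡2)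

      1+3k≢8 : ∀ k → 1 + (k + k) + k ≢ 8
      1+3k≢8 0 ()
      1+3k≢8 1 ()
      1+3k≢8 2 ()
      1+3k≢8 (suc (suc (suc k))) eq = contradiction (subst (10 ≤_) eq 10≤) (from-no (10 ≤? 8))
        where
        3≤ : 3 ≤ 3 + k
        3≤ = m≤m+n 3 k
        10≤ : 10 ≤ 1 + ((3 + k) + (3 + k)) + (3 + k)
        10≤ = +-mono-≤ (s≤s (+-mono-≤ 3≤ 3≤)) 3≤

      double-count : count isC + count isC ≡ count (adj G h)
      double-count = begin
        count isC + count isC                                 ≡⟨ ∑-distrib-+ (𝟙 ∘ isC) (𝟙 ∘ isC) ⟨
        ∑[ x < n G ] (𝟙 (isC x) + 𝟙 (isC x))                  ≡⟨ sum-cong-≗ row ⟩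
        ∑[ x < n G ] ∑[ y < n G ] 𝟙 (isC x ∧ adj G y x)      ≡⟨ ∑-comm (λ x y → 𝟙 (isC x ∧ adj G y x)) ⟩
        ∑[ y < n G ] ∑[ x < n G ] 𝟙 (isC x ∧ adj G y x)      ≡⟨ sum-cong-≗ C-neighbours ⟩
        count (adj G h)                                       ∎
        where
        open ≡-Reasoning
        row : ∀ x → 𝟙 (isC x) + 𝟙 (isC x) ≡ count (λ y → isC x ∧ adj G y x)
        row x with isC x in Cx
        ... | false = sym (count-false (n G))
        ... | true  = sym (trans (count-cong (λ y → Graph.sym G y x)) (degree-C (⌊⌋-sound (d x h ≟ℕ 2) Cx)))

      order : n G ≡ 1 + (count isC + count isC) + count isC
      order = begin
        n G                                                          ≡⟨ count-true (n G) ⟨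
        ∑[ x < n G ] 1                                               ≡⟨ sum-cong-≗ partition ⟨
        ∑[ x < n G ] (𝟙 ⌊ x ≟ h ⌋ + 𝟙 (adj G h x) + 𝟙 (isC x))      ≡⟨ ∑-distrib-+ (λ x → 𝟙 ⌊ x ≟ h ⌋ + 𝟙 (adj G h x)) (𝟙 ∘ isC) ⟩
        ∑[ x < n G ] (𝟙 ⌊ x ≟ h ⌋ + 𝟙 (adj G h x)) + count isC       ≡⟨ cong (_+ count isC) (∑-distrib-+ (λ x → 𝟙 ⌊ x ≟ h ⌋) (𝟙 ∘ adj G h)) ⟩
        count (λ x → ⌊ x ≟ h ⌋) + count (adj G h) + count isC       ≡⟨ cong₂ (λ s t → s + t + count isC) (count-≟ h) (sym double-count) ⟩
        1 + (count isC + count isC) + count isC                      ∎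
        where open ≡-Reasoning

      absurd : ⊥
      absurd = 1+3k≢8 (count isC) (trans (sym order) n≡8)

    hubs : n G ≡ 8 → ∃ λ c → h ≢ c × CompleteBipartite G (pair h c)
    hubs n≡8 with any? (λ b → any? (λ c →
                    (adj G h b ≟ᵇ true) ×-dec (adj G b c ≟ᵇ true) ×-dec (d c h ≟ℕ 2) ×-dec (W G b c ≟ℕ 2)))
    ... | yes (b , c , h~b , b~c , dch≡2 , Wbc≡2) = c , h≢c , SecondHub.complete h~b b~c dch≡2 Wbc≡2
      where
      h≢c : h ≢ c
      h≢c refl = contradiction (trans (sym dch≡2) (d-refl h)) λ ()
    ... | no ¬second-hub = ⊥-elim (NoSecondHub.absurd n≡8 outer-small)
      where
      outer-small : ∀ {b c} → h ~ b → b ~ c → d c h ≡ 2 → W G c b ≡ 2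
      outer-small {b} {c} h~b b~c dch≡2 with W-sides gndb b~c
      ... | inj₁ (_ , Wcb≡2) = Wcb≡2
      ... | inj₂ (_ , Wbc≡2) = contradiction (b , c , h~b , b~c , dch≡2 , Wbc≡2) ¬second-hub

part : Fin 8 → Bool
part x = toℕ x <ᵇ 2

K₂₆-complete : CompleteBipartite K₂₆ part
K₂₆-complete = record { adj≡xor = adj≡ }
  where
  adj≡ : ∀ x y → adj K₂₆ x y ≡ part x xor part y
  adj≡ zero          zero          = refl
  adj≡ zero          (suc zero)    = refl
  adj≡ zero          (suc (suc _)) = refl
  adj≡ (suc zero)    zero          = refl
  adj≡ (suc zero)    (suc zero)    = refl
  adj≡ (suc zero)    (suc (suc _)) = refl
  adj≡ (suc (suc _)) zero          = refl
  adj≡ (suc (suc _)) (suc zero)    = refl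
  adj≡ (suc (suc _)) (suc (suc _)) = refl

≅-complete : ∀ {G H P Q} → CompleteBipartite G P → CompleteBipartite H Q →
             (f : Fin (n G) ⤖ Fin (n H)) → (∀ x → Q (Bijection.to f x) ≡ P x) → G ≅ H
≅-complete cbG cbH f Q∘f≗P = f , λ x y →
  trans (adj≡xor cbG x y) (trans (sym (cong₂ _xor_ (Q∘f≗P x) (Q∘f≗P y))) (sym (adj≡xor cbH _ _)))

≅-pullback : ∀ {G H Q} → ((f , _) : G ≅ H) → CompleteBipartite H Q → CompleteBipartite G (Q ∘ Bijection.to f)
≅-pullback (f , adj-pres) cbH = record { adj≡xor = λ x y → trans (adj-pres x y) (adj≡xor cbH _ _) }

⌊≟⌋-injective : ∀ {m k} {f : Fin m → Fin k} → (∀ {x y} → f x ≡ f y → x ≡ y) →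
                ∀ x y → ⌊ f x ≟ f y ⌋ ≡ ⌊ x ≟ y ⌋
⌊≟⌋-injective {f = f} f-inj x y = trans (isYes≗does (f x ≟ f y))
  (trans (does-⇔ (mk⇔ f-inj (cong f)) (f x ≟ f y) (x ≟ y)) (sym (isYes≗does (x ≟ y))))

pair-image : ∀ {m k} {f : Fin m → Fin k} → (∀ {x y} → f x ≡ f y → x ≡ y) →
             ∀ u v x → pair (f u) (f v) (f x) ≡ pair u v x
pair-image f-inj u v x = cong₂ _∨_ (⌊≟⌋-injective f-inj x u) (⌊≟⌋-injective f-inj x v)

part≡pair : ∀ x → part x ≡ pair zero (suc zero) x
part≡pair zero          = refl
part≡pair (suc zero)    = refl
part≡pair (suc (suc x)) = refl

transpose-matchˡ : ∀ {m} (i j : Fin m) → PC.transpose i j i ≡ j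
transpose-matchˡ i j rewrite dec-true (i ≟ i) refl = refl

transpose-other : ∀ {m} {i j k : Fin m} → k ≢ i → k ≢ j → PC.transpose i j k ≡ k
transpose-other {i = i} {j} {k} k≢i k≢j rewrite dec-false (k ≟ i) k≢i | dec-false (k ≟ j) k≢j = refl

permutation-injective : ∀ {m k} (π : Permutation m k) → ∀ {x y} → π ⟨$⟩ʳ x ≡ π ⟨$⟩ʳ y → x ≡ y
permutation-injective π e = trans (sym (inverseˡ π)) (trans (cong (π ⟨$⟩ˡ_) e) (inverseˡ π))

hubs-to-front : ∀ {m} → m ≡ 8 → (h c : Fin m) → h ≢ c →
                Σ (Fin m ⤖ Fin 8) λ f → ∀ x → part (Bijection.to f x) ≡ pair h c x
hubs-to-front refl h c h≢c = ↔⇒⤖ π , λ x → begin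
  part (π ⟨$⟩ʳ x)                        ≡⟨ part≡pair (π ⟨$⟩ʳ x) ⟩
  pair zero (suc zero) (π ⟨$⟩ʳ x)        ≡⟨ cong₂ (λ u v → pair u v (π ⟨$⟩ʳ x)) πh≡0 πc≡1 ⟨
  pair (π ⟨$⟩ʳ h) (π ⟨$⟩ʳ c) (π ⟨$⟩ʳ x)  ≡⟨ pair-image (permutation-injective π) h c x ⟩
  pair h c x                             ∎
  where
  open ≡-Reasoning
  σ = transpose h zero
  c′ = σ ⟨$⟩ʳ c
  π = σ ∘ₚ transpose c′ (suc zero)
  0≢c′ : zero ≢ c′
  0≢c′ 0≡c′ = h≢c (permutation-injective σ (trans (transpose-matchˡ h zero) 0≡c′))
  πh≡0 : π ⟨$⟩ʳ h ≡ zero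
  πh≡0 = trans (cong (PC.transpose c′ (suc zero)) (transpose-matchˡ h zero)) (transpose-other 0≢c′ λ ())
  πc≡1 : π ⟨$⟩ʳ c ≡ suc zero
  πc≡1 = transpose-matchˡ c′ (suc zero)

hubs⇒≅K₂₆ : ∀ {G h c} → n G ≡ 8 → h ≢ c → CompleteBipartite G (pair h c) → G ≅ K₂₆
hubs⇒≅K₂₆ {G} {h} {c} n≡8 h≢c cb with hubs-to-front n≡8 h c h≢c
... | f , part∘f≗pair = ≅-complete cb K₂₆-complete f part∘f≗pair

≅K₂₆⇒3GNDB : ∀ {G} → G ≅ K₂₆ → Is3GNDBWith G 2
≅K₂₆⇒3GNDB {G} iso@(f , _) =
  completeBipartite⇒3GNDB (≤-reflexive (sym (↔⇒≡ π))) (≅-pullback iso K₂₆-complete)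
    (sym (∑-permute (𝟙 ∘ part) π)) (sym (∑-permute (𝟙 ∘ not ∘ part) π))
  where
  π = ⤖⇒↔ f

3GNDB₂⇒hubs : ∀ {G} → Connected G → HasEdge G → Is3GNDBWith G 2 →
              n G ≡ 8 × ∃₂ λ h c → h ≢ c × CompleteBipartite G (pair h c)
3GNDB₂⇒hubs {G} conn (a , b , a~b) gndb = n≡8 a~b , h , hubs (n≡8 a~b)
  where
  8≤n = 3GNDB₂⇒8≤n gndb a~b
  open GNDB₂ G (exactDist 8≤n (diameterBelow8 conn 8≤n gndb)) gndb
  open Hub a

theorem2p5 : (Γ : Graph) → Connected Γ → HasEdge Γ →
    (Is3GNDBWith Γ 2 ⇔ (Γ ≅ K₂₆))
theorem2p5 Γ conn edge = mk⇔ forward ≅K₂₆⇒3GNDB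
  where
  forward : Is3GNDBWith Γ 2 → Γ ≅ K₂₆
  forward gndb with 3GNDB₂⇒hubs conn edge gndb
  ... | n≡8 , h , c , h≢c , cb = hubs⇒≅K₂₆ n≡8 h≢c cb
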